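{- Let $M=x^2+x+1\in\mathbb{F}_2[x]$, $r\ge2$, $1\le j\le 2^{r-1}-1$, and $A=(1+M)^{2^r-j}+1$. Then $\ell_A=2^r+1$.
   Context: For nonzero $A\in\mathbb{F}_2[x]$, the Collatz transformations are: $A_0=A$, and for $k\ge0$, $A_{2k+1}=A_{2k}/(x^{a_{2k}}(x+1)^{b_{2k}})$ where $a_{2k},b_{2k}$ are the multiplicities of $x$ and $x+1$ in $A_{2k}$, and $A_{2k+2}=1+MA_{2k+1}$. The length $\ell_A$ is $1+\min\{k\ge0: A_{2k+1}=1\}$, i.e. the number of terms of the sequence $A_1,A_3,A_5,\dots$ up to and including its first term equal to $1$. -}

module Defs where

open import Data.Bool using (Bool; true; false; _xor_; if_then_else_)
open import Data.List using (List; []; _∷_; length)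
open import Data.Nat using (ℕ; zero; suc; _<_)
open import Data.Product using (Σ; _×_)
open import Relation.Binary.PropositionalEquality using (_≡_)
open import Relation.Nullary using (¬_)

-- Polynomials over 𝔽₂ as coefficient lists, lowest degree first
-- (true = 1, false = 0).  Trailing zeros are allowed; equality of
-- polynomials is equality after normalisation.
Poly : Set
Poly = List Bool

norm : Poly → Poly
norm [] = []
norm (a ∷ p) with norm p
... | [] = if a then true ∷ [] else []
... | q@(_ ∷ _) = a ∷ q

zeroP oneP : Poly
zeroP = []
oneP = true ∷ []

xPlus1 : Poly
xPlus1 = true ∷ true ∷ []

infixl 6 _⊕_
infixl 7 _⊗_

_⊕_ : Poly → Poly → Poly
[] ⊕ q = q
(a ∷ p) ⊕ [] = a ∷ p
(a ∷ p) ⊕ (b ∷ q) = (a xor b) ∷ (p ⊕ q)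

_⊗_ : Poly → Poly → Poly
[] ⊗ q = []
(a ∷ p) ⊗ q = (if a then q else []) ⊕ (false ∷ (p ⊗ q))

_^ₚ_ : Poly → ℕ → Poly
p ^ₚ zero = oneP
p ^ₚ suc n = p ⊗ (p ^ₚ n)

M : Poly
M = true ∷ true ∷ true ∷ []

IsOne : Poly → Set
IsOne p = norm p ≡ oneP

-- remove all factors x  (input assumed normalised; the zero polynomial ↦ 0)
stripX : Poly → Poly
stripX [] = []
stripX (false ∷ p) = stripX p
stripX (true ∷ p) = true ∷ p

-- value at x = 1 (sum of coefficients); p is divisible by x+1 iff this is 0
evalAt1 : Poly → Bool
evalAt1 [] = false
evalAt1 (a ∷ p) = a xor evalAt1 p

-- quotient of p by (x+1) when (x+1) ∣ p: q_i = p_0 + … + p_i, last one dropped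
private
  prefixXor : Bool → Poly → Poly
  prefixXor acc [] = []
  prefixXor acc (a ∷ p) = (acc xor a) ∷ prefixXor (acc xor a) p

  dropLast : Poly → Poly
  dropLast [] = []
  dropLast (a ∷ []) = []
  dropLast (a ∷ b ∷ p) = a ∷ dropLast (b ∷ p)

divXPlus1 : Poly → Poly
divXPlus1 p = norm (dropLast (prefixXor false p))

-- remove all factors (x+1), with fuel (degree bounds the multiplicity)
stripX1 : ℕ → Poly → Poly
stripX1 zero p = p
stripX1 (suc n) [] = []
stripX1 (suc n) (a ∷ p) with evalAt1 (a ∷ p)
... | true = a ∷ p
... | false = stripX1 n (divXPlus1 (a ∷ p))

-- A ↦ A / (x^a (x+1)^b), a, b the multiplicities of x and x+1 in A
core : Poly → Poly
core p = stripX1 (length (norm p)) (stripX (norm p))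

-- collatzOdd A k = A_{2k+1}
--   A_1 = core A,  A_{2k+3} = core (A_{2k+2}) = core (1 + M·A_{2k+1})
collatzOdd : Poly → ℕ → Poly
collatzOdd A zero = core A
collatzOdd A (suc k) = core (oneP ⊕ M ⊗ collatzOdd A k)

-- ℓ_A = 1 + min{k ≥ 0 : A_{2k+1} = 1}
CollatzLength : Poly → ℕ → Set
CollatzLength A ℓ =
  Σ ℕ (λ k → (ℓ ≡ suc k) × IsOne (collatzOdd A k)
             × (∀ i → i < k → ¬ IsOne (collatzOdd A i)))

-- Put u = x² + x = 1 + M, so that A = u^n + 1 with n = 2^r − j and 2^(r−1) < n < 2^r.
-- As a polynomial in x, G(x² + x) with G(0) = 1 is prime to x and to x + 1, so the odd
-- Collatz iterates of A are G(x² + x) for G following G ↦ (1 + (1 + u) G) / u^v in 𝔽₂[u].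
-- Reflection R = u^(deg G) G(1/u) turns this step into R ↦ (1 + u) R + u^(deg R + 1), and
-- A into the palindrome u^n + 1, whose orbit is u^n + (1 + u)^k for k ≤ n. Since
-- (1 + u)^(2^s) = 1 + u^(2^s), the polynomial (1 + u)^(2^s + b) + u^(2^s + b) equals
-- u^(2^s) ((1 + u)^b + u^b) + (1 + u)^b, whose lower part evolves on its own; by induction on s,
-- (1 + u)^a + u^a reaches 1 after 2^s − a steps when 1 ≤ a ≤ 2^s. Until then every iterate
-- keeps a term u^n or u^(2^(r−1)), so 1 is first reached after exactly 2^r steps.

{-# OPTIONS --safe #-}
module Submission where

open import Defs
open import Data.Bool using (Bool; true; false; _xor_; if_then_else_; _∧_)
open import Data.Bool.Properties
  using (xor-same; xor-assoc; xor-comm; xor-identityʳ; ∧-distribʳ-xor; xor-∧-commutativeRing)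
open import Data.Empty using (⊥-elim)
open import Data.List using ([]; _∷_; length; _++_; replicate; reverse)
open import Data.List.Properties
  using (length-++; length-++-comm; length-replicate; length-reverse; reverse-++; unfold-reverse)
open import Data.Nat using (ℕ; zero; suc; _+_; _^_; _≤_; _<_; _∸_; z≤n; s≤s; _≤?_; _<?_)
open import Data.Nat.Properties
open import Data.Nat.Tactic.RingSolver using (solve-∀)
open import Data.Product using (∃; _,_; proj₁; proj₂)
open import Data.Sum using (inj₁; inj₂)
open import Level using (0ℓ)
open import Relation.Binary.Bundles using (Setoid)
open import Relation.Binary.PropositionalEquality
open import Relation.Nullary using (¬_; yes; no)
import Relation.Binary.Reasoning.Setoid as SetoidReasoning
open import Algebra.Bundles using (CommutativeRing; CommutativeSemigroup)
open import Algebra.Properties.CommutativeSemigroup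
  (CommutativeRing.+-commutativeSemigroup xor-∧-commutativeRing)
  using () renaming (interchange to xor-interchange)
import Algebra.Properties.CommutativeSemigroup

true≢false : true ≢ false
true≢false ()

coeff : Poly → ℕ → Bool
coeff []      _       = false
coeff (a ∷ p) zero    = a
coeff (a ∷ p) (suc i) = coeff p i

infix 4 _≈_
record _≈_ (p q : Poly) : Set where
  constructor mk≈
  field coeff-≡ : ∀ i → coeff p i ≡ coeff q i
open _≈_

≈-refl : ∀ {p} → p ≈ p
≈-refl = mk≈ λ _ → refl

≈-reflexive : ∀ {p q} → p ≡ q → p ≈ q
≈-reflexive refl = ≈-refl

≈-sym : ∀ {p q} → p ≈ q → q ≈ p
≈-sym p≈q = mk≈ λ i → sym (coeff-≡ p≈q i)

≈-trans : ∀ {p q r} → p ≈ q → q ≈ r → p ≈ r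
≈-trans p≈q q≈r = mk≈ λ i → trans (coeff-≡ p≈q i) (coeff-≡ q≈r i)

≈-setoid : Setoid 0ℓ 0ℓ
≈-setoid = record
  { Carrier       = Poly
  ; _≈_           = _≈_
  ; isEquivalence = record { refl = ≈-refl ; sym = ≈-sym ; trans = ≈-trans }
  }

module ≈-Reasoning = SetoidReasoning ≈-setoid

∷-cong : ∀ {a b p q} → a ≡ b → p ≈ q → a ∷ p ≈ b ∷ q
∷-cong a≡b p≈q = mk≈ λ { zero → a≡b ; (suc i) → coeff-≡ p≈q i }

∷-injectiveʳ : ∀ {a b p q} → a ∷ p ≈ b ∷ q → p ≈ q
∷-injectiveʳ e = mk≈ λ i → coeff-≡ e (suc i)

∷-≈[]⇒≈[] : ∀ {a p} → a ∷ p ≈ [] → p ≈ []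
∷-≈[]⇒≈[] e = mk≈ λ i → coeff-≡ e (suc i)

false∷-≈[] : ∀ {p} → p ≈ [] → false ∷ p ≈ []
false∷-≈[] p≈[] = mk≈ λ { zero → refl ; (suc i) → coeff-≡ p≈[] i }

replicate-false≈[] : ∀ m → replicate m false ≈ []
replicate-false≈[] zero    = ≈-refl
replicate-false≈[] (suc m) = false∷-≈[] (replicate-false≈[] m)

coeff-≥length : ∀ p {i} → length p ≤ i → coeff p i ≡ false
coeff-≥length []      _        = refl
coeff-≥length (a ∷ p) (s≤s le) = coeff-≥length p le

coeff-++ˡ : ∀ xs ys {i} → i < length xs → coeff (xs ++ ys) i ≡ coeff xs i
coeff-++ˡ (x ∷ xs) ys {zero}  _        = refl
coeff-++ˡ (x ∷ xs) ys {suc i} (s≤s lt) = coeff-++ˡ xs ys lt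

coeff-∷ʳ-length : ∀ xs (a : Bool) → coeff (xs ++ a ∷ []) (length xs) ≡ a
coeff-∷ʳ-length []       a = refl
coeff-∷ʳ-length (x ∷ xs) a = coeff-∷ʳ-length xs a

coeff-reverse : ∀ p {i} → i < length p → coeff (reverse p) i ≡ coeff p (length p ∸ suc i)
coeff-reverse (a ∷ p) {i} i≤p rewrite unfold-reverse a p with m<1+n⇒m<n∨m≡n i≤p
... | inj₁ i<p = begin
  coeff (reverse p ++ a ∷ []) i
    ≡⟨ coeff-++ˡ (reverse p) _ (subst (i <_) (sym (length-reverse p)) i<p) ⟩
  coeff (reverse p) i
    ≡⟨ coeff-reverse p i<p ⟩
  coeff (a ∷ p) (suc (length p ∸ suc i))
    ≡⟨ cong (coeff (a ∷ p)) (+-∸-assoc 1 i<p) ⟨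
  coeff (a ∷ p) (length p ∸ i) ∎
  where open ≡-Reasoning
... | inj₂ refl = begin
  coeff (reverse p ++ a ∷ []) (length p)            ≡⟨ cong (coeff (reverse p ++ a ∷ [])) (length-reverse p) ⟨
  coeff (reverse p ++ a ∷ []) (length (reverse p))  ≡⟨ coeff-∷ʳ-length (reverse p) a ⟩
  a                                                 ≡⟨ cong (coeff (a ∷ p)) (n∸n≡0 (length p)) ⟨
  coeff (a ∷ p) (length p ∸ length p)               ∎
  where open ≡-Reasoning

-- Ring laws up to coefficientwise equality

coeff-⊕ : ∀ p q i → coeff (p ⊕ q) i ≡ coeff p i xor coeff q i
coeff-⊕ []      q       i       = refl
coeff-⊕ (a ∷ p) []      i       = sym (xor-identityʳ _)
coeff-⊕ (a ∷ p) (b ∷ q) zero    = refl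
coeff-⊕ (a ∷ p) (b ∷ q) (suc i) = coeff-⊕ p q i

⊕-cong : ∀ {p p′ q q′} → p ≈ p′ → q ≈ q′ → p ⊕ q ≈ p′ ⊕ q′
⊕-cong {p} {p′} {q} {q′} p≈p′ q≈q′ = mk≈ λ i → begin
  coeff (p ⊕ q) i              ≡⟨ coeff-⊕ p q i ⟩
  coeff p i xor coeff q i      ≡⟨ cong₂ _xor_ (coeff-≡ p≈p′ i) (coeff-≡ q≈q′ i) ⟩
  coeff p′ i xor coeff q′ i    ≡⟨ coeff-⊕ p′ q′ i ⟨
  coeff (p′ ⊕ q′) i            ∎
  where open ≡-Reasoning

⊕-congˡ : ∀ {p q q′} → q ≈ q′ → p ⊕ q ≈ p ⊕ q′
⊕-congˡ = ⊕-cong ≈-refl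

⊕-congʳ : ∀ {p p′ q} → p ≈ p′ → p ⊕ q ≈ p′ ⊕ q
⊕-congʳ p≈p′ = ⊕-cong p≈p′ ≈-refl

⊕-identityʳ : ∀ p → p ⊕ [] ≡ p
⊕-identityʳ []      = refl
⊕-identityʳ (a ∷ p) = refl

⊕-comm : ∀ p q → p ⊕ q ≡ q ⊕ p
⊕-comm []      q       = sym (⊕-identityʳ q)
⊕-comm (a ∷ p) []      = refl
⊕-comm (a ∷ p) (b ∷ q) = cong₂ _∷_ (xor-comm a b) (⊕-comm p q)

⊕-assoc : ∀ p q r → (p ⊕ q) ⊕ r ≡ p ⊕ (q ⊕ r)
⊕-assoc []      q       r       = refl
⊕-assoc (a ∷ p) []      r       = refl
⊕-assoc (a ∷ p) (b ∷ q) []      = refl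
⊕-assoc (a ∷ p) (b ∷ q) (c ∷ r) = cong₂ _∷_ (xor-assoc a b c) (⊕-assoc p q r)

⊕-self : ∀ p → p ⊕ p ≈ []
⊕-self p = mk≈ λ i → trans (coeff-⊕ p p i) (xor-same (coeff p i))

p⊕q≈[]⇒p≈q : ∀ {p q} → p ⊕ q ≈ [] → p ≈ q
p⊕q≈[]⇒p≈q {p} {q} e = mk≈ λ i → xor≡false⇒≡ (trans (sym (coeff-⊕ p q i)) (coeff-≡ e i))
  where
  xor≡false⇒≡ : ∀ {a b} → a xor b ≡ false → a ≡ b
  xor≡false⇒≡ {false} {false} _ = refl
  xor≡false⇒≡ {true}  {true}  _ = refl

⊕-commutativeSemigroup : CommutativeSemigroup 0ℓ 0ℓ
⊕-commutativeSemigroup = record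
  { _∙_                    = _⊕_
  ; isCommutativeSemigroup = record
    { isSemigroup = record
      { isMagma = record { isEquivalence = isEquivalence ; ∙-cong = cong₂ _⊕_ }
      ; assoc   = ⊕-assoc
      }
    ; comm = ⊕-comm
    }
  }

module ⊕-Properties = Algebra.Properties.CommutativeSemigroup ⊕-commutativeSemigroup
open ⊕-Properties using () renaming (interchange to ⊕-interchange)

-- (a ∷ p) ⊗ q unfolds to scale a q ⊕ (false ∷ p ⊗ q)
scale : Bool → Poly → Poly
scale a q = if a then q else []

scale-xor : ∀ a b q → scale (a xor b) q ≈ scale a q ⊕ scale b q
scale-xor true  true  q = ≈-sym (⊕-self q)
scale-xor true  false q = ≈-reflexive (sym (⊕-identityʳ q))
scale-xor false b     q = ≈-refl

scale-⊕ : ∀ a p q → scale a (p ⊕ q) ≡ scale a p ⊕ scale a q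
scale-⊕ true  p q = refl
scale-⊕ false p q = refl

scale-⊗ : ∀ a q r → scale a q ⊗ r ≡ scale a (q ⊗ r)
scale-⊗ true  q r = refl
scale-⊗ false q r = refl

scale-cong : ∀ a {p q} → p ≈ q → scale a p ≈ scale a q
scale-cong true  p≈q = p≈q
scale-cong false _   = ≈-refl

⊗-zeroʳ : ∀ p → p ⊗ [] ≈ []
⊗-zeroʳ []          = ≈-refl
⊗-zeroʳ (true ∷ p)  = false∷-≈[] (⊗-zeroʳ p)
⊗-zeroʳ (false ∷ p) = false∷-≈[] (⊗-zeroʳ p)

≈[]⇒⊗≈[] : ∀ {p} q → p ≈ [] → p ⊗ q ≈ []
≈[]⇒⊗≈[] {[]}    q _ = ≈-refl
≈[]⇒⊗≈[] {a ∷ p} q e with coeff-≡ e zero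
... | refl = false∷-≈[] (≈[]⇒⊗≈[] q (∷-≈[]⇒≈[] e))

⊗-congʳ : ∀ {p p′} q → p ≈ p′ → p ⊗ q ≈ p′ ⊗ q
⊗-congʳ {[]}    {p′}     q e = ≈-sym (≈[]⇒⊗≈[] q (≈-sym e))
⊗-congʳ {a ∷ p} {[]}     q e = ≈[]⇒⊗≈[] q e
⊗-congʳ {a ∷ p} {b ∷ p′} q e with coeff-≡ e zero
... | refl = ⊕-congˡ (∷-cong refl (⊗-congʳ q (∷-injectiveʳ e)))

⊗-congˡ : ∀ p {q q′} → q ≈ q′ → p ⊗ q ≈ p ⊗ q′
⊗-congˡ []      _   = ≈-refl
⊗-congˡ (a ∷ p) q≈q′ = ⊕-cong (scale-cong a q≈q′) (∷-cong refl (⊗-congˡ p q≈q′))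

⊗-cong : ∀ {p p′ q q′} → p ≈ p′ → q ≈ q′ → p ⊗ q ≈ p′ ⊗ q′
⊗-cong {p′ = p′} {q = q} p≈p′ q≈q′ = ≈-trans (⊗-congʳ q p≈p′) (⊗-congˡ p′ q≈q′)

⊗-distribʳ : ∀ s p q → (p ⊕ q) ⊗ s ≈ p ⊗ s ⊕ q ⊗ s
⊗-distribʳ s []      q       = ≈-refl
⊗-distribʳ s (a ∷ p) []      = ≈-reflexive (sym (⊕-identityʳ _))
⊗-distribʳ s (a ∷ p) (b ∷ q) = begin
  scale (a xor b) s ⊕ (false ∷ (p ⊕ q) ⊗ s)
    ≈⟨ ⊕-cong (scale-xor a b s) (∷-cong refl (⊗-distribʳ s p q)) ⟩
  (scale a s ⊕ scale b s) ⊕ ((false ∷ p ⊗ s) ⊕ (false ∷ q ⊗ s))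
    ≡⟨ ⊕-interchange (scale a s) (scale b s) (false ∷ p ⊗ s) (false ∷ q ⊗ s) ⟩
  (a ∷ p) ⊗ s ⊕ (b ∷ q) ⊗ s ∎
  where open ≈-Reasoning

⊗-distribˡ : ∀ s p q → s ⊗ (p ⊕ q) ≈ s ⊗ p ⊕ s ⊗ q
⊗-distribˡ []      p q = ≈-refl
⊗-distribˡ (a ∷ s) p q = begin
  scale a (p ⊕ q) ⊕ (false ∷ s ⊗ (p ⊕ q))
    ≈⟨ ⊕-cong (≈-reflexive (scale-⊕ a p q)) (∷-cong refl (⊗-distribˡ s p q)) ⟩
  (scale a p ⊕ scale a q) ⊕ ((false ∷ s ⊗ p) ⊕ (false ∷ s ⊗ q))
    ≡⟨ ⊕-interchange (scale a p) (scale a q) (false ∷ s ⊗ p) (false ∷ s ⊗ q) ⟩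
  (a ∷ s) ⊗ p ⊕ (a ∷ s) ⊗ q ∎
  where open ≈-Reasoning

⊗-identityˡ : ∀ q → oneP ⊗ q ≈ q
⊗-identityˡ q = ≈-trans (⊕-congˡ (false∷-≈[] ≈-refl)) (≈-reflexive (⊕-identityʳ q))

⊗-false∷ : ∀ q r → q ⊗ (false ∷ r) ≈ false ∷ q ⊗ r
⊗-false∷ []         r = ≈-sym (false∷-≈[] ≈-refl)
⊗-false∷ (true ∷ q)  r = ∷-cong refl (⊕-congˡ (⊗-false∷ q r))
⊗-false∷ (false ∷ q) r = ∷-cong refl (⊗-false∷ q r)

⊗-singleton : ∀ q a → q ⊗ (a ∷ []) ≈ scale a q
⊗-singleton []      true  = ≈-refl
⊗-singleton []      false = ≈-refl
⊗-singleton (b ∷ q) a     = ≈-trans (⊕-congˡ (∷-cong refl (⊗-singleton q a))) (head b a)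
  where
  head : ∀ b a → scale b (a ∷ []) ⊕ (false ∷ scale a q) ≈ scale a (b ∷ q)
  head true  true  = ≈-refl
  head false true  = ≈-refl
  head true  false = false∷-≈[] ≈-refl
  head false false = false∷-≈[] ≈-refl

⊗-identityʳ : ∀ q → q ⊗ oneP ≈ q
⊗-identityʳ q = ⊗-singleton q true

⊗-comm : ∀ p q → p ⊗ q ≈ q ⊗ p
⊗-comm []      q = ≈-sym (⊗-zeroʳ q)
⊗-comm (a ∷ p) q = begin
  scale a q ⊕ (false ∷ p ⊗ q)       ≈⟨ ⊕-cong (≈-sym (⊗-singleton q a)) (∷-cong refl (⊗-comm p q)) ⟩
  q ⊗ (a ∷ []) ⊕ (false ∷ q ⊗ p)    ≈⟨ ⊕-congˡ (⊗-false∷ q p) ⟨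
  q ⊗ (a ∷ []) ⊕ q ⊗ (false ∷ p)    ≈⟨ ⊗-distribˡ q (a ∷ []) (false ∷ p) ⟨
  q ⊗ ((a xor false) ∷ p)           ≡⟨ cong (λ b → q ⊗ (b ∷ p)) (xor-identityʳ a) ⟩
  q ⊗ (a ∷ p)                       ∎
  where open ≈-Reasoning

⊗-assoc : ∀ p q r → (p ⊗ q) ⊗ r ≈ p ⊗ (q ⊗ r)
⊗-assoc []      q r = ≈-refl
⊗-assoc (a ∷ p) q r = begin
  (scale a q ⊕ (false ∷ p ⊗ q)) ⊗ r
    ≈⟨ ⊗-distribʳ r (scale a q) (false ∷ p ⊗ q) ⟩
  scale a q ⊗ r ⊕ (false ∷ (p ⊗ q) ⊗ r)
    ≈⟨ ⊕-cong (≈-reflexive (scale-⊗ a q r)) (∷-cong refl (⊗-assoc p q r)) ⟩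
  (a ∷ p) ⊗ (q ⊗ r) ∎
  where open ≈-Reasoning

⊗-commutativeSemigroup : CommutativeSemigroup 0ℓ 0ℓ
⊗-commutativeSemigroup = record
  { _∙_                    = _⊗_
  ; isCommutativeSemigroup = record
    { isSemigroup = record
      { isMagma = record { isEquivalence = Setoid.isEquivalence ≈-setoid ; ∙-cong = ⊗-cong }
      ; assoc   = ⊗-assoc
      }
    ; comm = ⊗-comm
    }
  }

module ⊗-Properties = Algebra.Properties.CommutativeSemigroup ⊗-commutativeSemigroup
open ⊗-Properties using () renaming (interchange to ⊗-interchange)

^ₚ-congʳ : ∀ n {p q} → p ≈ q → p ^ₚ n ≈ q ^ₚ n
^ₚ-congʳ zero    _   = ≈-refl
^ₚ-congʳ (suc n) p≈q = ⊗-cong p≈q (^ₚ-congʳ n p≈q)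

^ₚ-homo-⊗ : ∀ p m n → p ^ₚ (m + n) ≈ p ^ₚ m ⊗ p ^ₚ n
^ₚ-homo-⊗ p zero    n = ≈-sym (⊗-identityˡ _)
^ₚ-homo-⊗ p (suc m) n = ≈-trans (⊗-congˡ p (^ₚ-homo-⊗ p m n)) (≈-sym (⊗-assoc p (p ^ₚ m) (p ^ₚ n)))

^ₚ-distrib-⊗ : ∀ p q n → (p ⊗ q) ^ₚ n ≈ p ^ₚ n ⊗ q ^ₚ n
^ₚ-distrib-⊗ p q zero    = ≈-sym (⊗-identityˡ oneP)
^ₚ-distrib-⊗ p q (suc n) = ≈-trans (⊗-congˡ (p ⊗ q) (^ₚ-distrib-⊗ p q n)) (⊗-interchange p q _ _)

oneP⊕-square : ∀ y → (oneP ⊕ y) ⊗ (oneP ⊕ y) ≈ oneP ⊕ y ⊗ y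
oneP⊕-square y = begin
  (oneP ⊕ y) ⊗ (oneP ⊕ y)              ≈⟨ ⊗-distribʳ (oneP ⊕ y) oneP y ⟩
  oneP ⊗ (oneP ⊕ y) ⊕ y ⊗ (oneP ⊕ y)    ≈⟨ ⊕-cong (⊗-identityˡ (oneP ⊕ y)) (⊗-distribˡ y oneP y) ⟩
  (oneP ⊕ y) ⊕ (y ⊗ oneP ⊕ y ⊗ y)       ≈⟨ ⊕-congˡ {oneP ⊕ y} (⊕-congʳ (⊗-identityʳ y)) ⟩
  (oneP ⊕ y) ⊕ (y ⊕ y ⊗ y)              ≡⟨ ⊕-assoc oneP y (y ⊕ y ⊗ y) ⟩
  oneP ⊕ (y ⊕ (y ⊕ y ⊗ y))              ≡⟨ cong (oneP ⊕_) (⊕-assoc y y (y ⊗ y)) ⟨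
  oneP ⊕ ((y ⊕ y) ⊕ y ⊗ y)              ≈⟨ ⊕-congˡ {oneP} (⊕-congʳ (⊕-self y)) ⟩
  oneP ⊕ y ⊗ y                          ∎
  where open ≈-Reasoning

evalAt1-⊕ : ∀ p q → evalAt1 (p ⊕ q) ≡ evalAt1 p xor evalAt1 q
evalAt1-⊕ []      q       = refl
evalAt1-⊕ (a ∷ p) []      = sym (xor-identityʳ _)
evalAt1-⊕ (a ∷ p) (b ∷ q) =
  trans (cong ((a xor b) xor_) (evalAt1-⊕ p q)) (xor-interchange a b (evalAt1 p) (evalAt1 q))

evalAt1-≈[] : ∀ {p} → p ≈ [] → evalAt1 p ≡ false
evalAt1-≈[] {[]}    _ = refl
evalAt1-≈[] {a ∷ p} e rewrite coeff-≡ e zero = evalAt1-≈[] (∷-≈[]⇒≈[] e)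

evalAt1-cong : ∀ {p q} → p ≈ q → evalAt1 p ≡ evalAt1 q
evalAt1-cong {[]}    {q}     e = sym (evalAt1-≈[] (≈-sym e))
evalAt1-cong {a ∷ p} {[]}    e = evalAt1-≈[] e
evalAt1-cong {a ∷ p} {b ∷ q} e = cong₂ _xor_ (coeff-≡ e zero) (evalAt1-cong (∷-injectiveʳ e))

evalAt1-⊗ : ∀ p q → evalAt1 (p ⊗ q) ≡ evalAt1 p ∧ evalAt1 q
evalAt1-⊗ []      q = refl
evalAt1-⊗ (a ∷ p) q = begin
  evalAt1 (scale a q ⊕ (false ∷ p ⊗ q))     ≡⟨ evalAt1-⊕ (scale a q) (false ∷ p ⊗ q) ⟩
  evalAt1 (scale a q) xor evalAt1 (p ⊗ q)   ≡⟨ cong₂ _xor_ (evalAt1-scale a) (evalAt1-⊗ p q) ⟩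
  (a ∧ evalAt1 q) xor (evalAt1 p ∧ evalAt1 q) ≡⟨ ∧-distribʳ-xor (evalAt1 q) a (evalAt1 p) ⟨
  (a xor evalAt1 p) ∧ evalAt1 q             ∎
  where
  open ≡-Reasoning
  evalAt1-scale : ∀ a → evalAt1 (scale a q) ≡ a ∧ evalAt1 q
  evalAt1-scale true  = refl
  evalAt1-scale false = refl

coeff₀-⊗ : ∀ p q → coeff (p ⊗ q) 0 ≡ coeff p 0 ∧ coeff q 0
coeff₀-⊗ []      q = refl
coeff₀-⊗ (a ∷ p) q = trans (coeff-⊕ (scale a q) (false ∷ p ⊗ q) 0) (trans (xor-identityʳ _) (coeff₀-scale a))
  where
  coeff₀-scale : ∀ a → coeff (scale a q) 0 ≡ a ∧ coeff q 0
  coeff₀-scale true  = refl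
  coeff₀-scale false = refl

monomial : ℕ → Poly
monomial m = replicate m false ++ true ∷ []

monomial-⊗ : ∀ m q → monomial m ⊗ q ≈ replicate m false ++ q
monomial-⊗ zero    q = ⊗-identityˡ q
monomial-⊗ (suc m) q = ∷-cong refl (monomial-⊗ m q)

monomial-+ : ∀ m n → monomial m ⊗ monomial n ≈ monomial (m + n)
monomial-+ zero    n = ⊗-identityˡ (monomial n)
monomial-+ (suc m) n = ∷-cong refl (monomial-+ m n)

evalAt1-monomial : ∀ m → evalAt1 (monomial m) ≡ true
evalAt1-monomial zero    = refl
evalAt1-monomial (suc m) = evalAt1-monomial m

normCons : Bool → Poly → Poly
normCons a []        = if a then true ∷ [] else []
normCons a q@(_ ∷ _) = a ∷ q

norm-∷ : ∀ a p → norm (a ∷ p) ≡ normCons a (norm p)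
norm-∷ a p with norm p
... | []    = refl
... | _ ∷ _ = refl

normCons≈ : ∀ a q → normCons a q ≈ a ∷ q
normCons≈ true  []      = ≈-refl
normCons≈ false []      = ≈-sym (false∷-≈[] ≈-refl)
normCons≈ a     (_ ∷ _) = ≈-refl

normCons-nonempty : ∀ a q → 1 ≤ length q → normCons a q ≡ a ∷ q
normCons-nonempty a (_ ∷ _) _ = refl

norm≈ : ∀ p → norm p ≈ p
norm≈ []      = ≈-refl
norm≈ (a ∷ p) rewrite norm-∷ a p = ≈-trans (normCons≈ a (norm p)) (∷-cong refl (norm≈ p))

≈[]⇒norm≡[] : ∀ {p} → p ≈ [] → norm p ≡ []
≈[]⇒norm≡[] {[]}    _ = refl
≈[]⇒norm≡[] {a ∷ p} e
  rewrite norm-∷ a p | ≈[]⇒norm≡[] (∷-≈[]⇒≈[] e) | coeff-≡ e zero = refl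

≈⇒norm≡ : ∀ {p q} → p ≈ q → norm p ≡ norm q
≈⇒norm≡ {[]}    {q}     e = sym (≈[]⇒norm≡[] (≈-sym e))
≈⇒norm≡ {a ∷ p} {[]}    e = ≈[]⇒norm≡[] e
≈⇒norm≡ {a ∷ p} {b ∷ q} e
  rewrite norm-∷ a p | norm-∷ b q | ≈⇒norm≡ (∷-injectiveʳ e) | coeff-≡ e zero = refl

-- degree + 1, and 0 for the zero polynomial
size : Poly → ℕ
size p = length (norm p)

size-cong : ∀ {p q} → p ≈ q → size p ≡ size q
size-cong p≈q = cong length (≈⇒norm≡ p≈q)

coeff-≥size : ∀ p {i} → size p ≤ i → coeff p i ≡ false
coeff-≥size p {i} le = trans (sym (coeff-≡ (norm≈ p) i)) (coeff-≥length (norm p) le)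

coeff≡true⇒<size : ∀ p {i} → coeff p i ≡ true → i < size p
coeff≡true⇒<size p {i} c with i <? size p
... | yes lt = lt
... | no ¬lt = ⊥-elim (true≢false (trans (sym c) (coeff-≥size p (≮⇒≥ ¬lt))))

coeff-top : ∀ p k → size p ≡ suc k → coeff p k ≡ true
coeff-top []      k ()
coeff-top (a ∷ p) k e = top a (norm p) refl (trans (cong length (sym (norm-∷ a p))) e)
  where
  top : ∀ a q → norm p ≡ q → length (normCons a q) ≡ suc k → coeff (a ∷ p) k ≡ true
  top true  []      _  l = subst (λ k → coeff (true ∷ p) k ≡ true) (suc-injective l) refl
  top a     (b ∷ q) eq l =
    subst (λ k → coeff (a ∷ p) k ≡ true) (suc-injective l) (coeff-top p (length q) (cong length eq))

size-≤ : ∀ p n → (∀ i → n ≤ i → coeff p i ≡ false) → size p ≤ n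
size-≤ p n above with size p in eq
... | zero  = z≤n
... | suc k with k <? n
...   | yes k<n = k<n
...   | no  k≮n = ⊥-elim (true≢false (trans (sym (coeff-top p k eq)) (above k (≮⇒≥ k≮n))))

size-≡ : ∀ p k → coeff p k ≡ true → (∀ i → suc k ≤ i → coeff p i ≡ false) → size p ≡ suc k
size-≡ p k top above = ≤-antisym (size-≤ p (suc k) above) (coeff≡true⇒<size p top)

size-⊕-dominant : ∀ h l → size l < size h → size (h ⊕ l) ≡ size h
size-⊕-dominant h l l<h with size h in eq
... | suc k = size-≡ (h ⊕ l) k top above
  where
  top : coeff (h ⊕ l) k ≡ true
  top rewrite coeff-⊕ h l k | coeff-top h k eq | coeff-≥size l (≤-pred l<h) = refl
  above : ∀ i → suc k ≤ i → coeff (h ⊕ l) i ≡ false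
  above i le rewrite coeff-⊕ h l i | coeff-≥size h (subst (_≤ i) (sym eq) le)
    | coeff-≥size l (≤-trans (≤-pred l<h) (≤-trans (n≤1+n k) le)) = refl

norm-shift : ∀ h x → 1 ≤ size x → norm (replicate h false ++ x) ≡ replicate h false ++ norm x
norm-shift zero    x _  = refl
norm-shift (suc h) x nz = begin
  norm (false ∷ replicate h false ++ x)           ≡⟨ norm-∷ false (replicate h false ++ x) ⟩
  normCons false (norm (replicate h false ++ x))  ≡⟨ cong (normCons false) (norm-shift h x nz) ⟩
  normCons false (replicate h false ++ norm x)    ≡⟨ normCons-nonempty false _ nonempty ⟩
  false ∷ replicate h false ++ norm x            ∎
  where
  open ≡-Reasoning
  nonempty : 1 ≤ length (replicate h false ++ norm x)
  nonempty = ≤-trans nz (subst (size x ≤_) (sym (length-++ (replicate h false))) (m≤n+m _ _))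

size-shift : ∀ h x → 1 ≤ size x → size (replicate h false ++ x) ≡ h + size x
size-shift h x nz = begin
  length (norm (replicate h false ++ x))  ≡⟨ cong length (norm-shift h x nz) ⟩
  length (replicate h false ++ norm x)    ≡⟨ length-++ (replicate h false) ⟩
  length (replicate h false) + size x     ≡⟨ cong (_+ size x) (length-replicate h) ⟩
  h + size x                              ∎
  where open ≡-Reasoning

size-monomial-⊗ : ∀ h x → 1 ≤ size x → size (monomial h ⊗ x) ≡ h + size x
size-monomial-⊗ h x nz = trans (size-cong (monomial-⊗ h x)) (size-shift h x nz)

evalAt1≡true⇒1≤size : ∀ p → evalAt1 p ≡ true → 1 ≤ size p
evalAt1≡true⇒1≤size p e with norm p in eq
... | _ ∷ _ = s≤s z≤n
... | []    = ⊥-elim (true≢false (trans (sym e) (evalAt1-≈[] p≈[])))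
  where
  p≈[] : p ≈ []
  p≈[] = ≈-trans (≈-sym (norm≈ p)) (≈-reflexive eq)

xPlus1-⊗ : ∀ y → xPlus1 ⊗ y ≈ (false ∷ y) ⊕ y
xPlus1-⊗ y = ≈-trans (⊕-congˡ (∷-cong refl (⊗-identityˡ y))) (≈-reflexive (⊕-comm y (false ∷ y)))

xPlus1-⊗-≈[] : ∀ {y} → xPlus1 ⊗ y ≈ [] → y ≈ []
xPlus1-⊗-≈[] {y} e = mk≈ vanishes
  where
  shift : false ∷ y ≈ y
  shift = p⊕q≈[]⇒p≈q (≈-trans (≈-sym (xPlus1-⊗ y)) e)
  vanishes : ∀ i → coeff y i ≡ false
  vanishes zero    = sym (coeff-≡ shift zero)
  vanishes (suc i) = trans (sym (coeff-≡ shift (suc i))) (vanishes i)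

xPlus1-⊗-cancel : ∀ {y z} → xPlus1 ⊗ y ≈ xPlus1 ⊗ z → y ≈ z
xPlus1-⊗-cancel {y} {z} e = p⊕q≈[]⇒p≈q (xPlus1-⊗-≈[] (begin
  xPlus1 ⊗ (y ⊕ z)             ≈⟨ ⊗-distribˡ xPlus1 y z ⟩
  xPlus1 ⊗ y ⊕ xPlus1 ⊗ z      ≈⟨ ⊕-congʳ e ⟩
  xPlus1 ⊗ z ⊕ xPlus1 ⊗ z      ≈⟨ ⊕-self (xPlus1 ⊗ z) ⟩
  []                           ∎))
  where open ≈-Reasoning

size-xPlus1-⊗ : ∀ y → 1 ≤ size y → size (xPlus1 ⊗ y) ≡ suc (size y)
size-xPlus1-⊗ y nz = begin
  size (xPlus1 ⊗ y)       ≡⟨ size-cong (xPlus1-⊗ y) ⟩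
  size ((false ∷ y) ⊕ y)  ≡⟨ size-⊕-dominant (false ∷ y) y (≤-reflexive (sym (size-shift 1 y nz))) ⟩
  size (false ∷ y)        ≡⟨ size-shift 1 y nz ⟩
  suc (size y)            ∎
  where open ≡-Reasoning

size-xPlus1^-⊗ : ∀ b y → 1 ≤ size y → size (xPlus1 ^ₚ b ⊗ y) ≡ b + size y
size-xPlus1^-⊗ zero    y nz = size-cong (⊗-identityˡ y)
size-xPlus1^-⊗ (suc b) y nz = begin
  size ((xPlus1 ⊗ xPlus1 ^ₚ b) ⊗ y)
    ≡⟨ size-cong (⊗-assoc xPlus1 (xPlus1 ^ₚ b) y) ⟩
  size (xPlus1 ⊗ (xPlus1 ^ₚ b ⊗ y))
    ≡⟨ size-xPlus1-⊗ (xPlus1 ^ₚ b ⊗ y) (subst (1 ≤_) (sym ih) (≤-trans nz (m≤n+m _ b))) ⟩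
  suc (size (xPlus1 ^ₚ b ⊗ y))
    ≡⟨ cong suc ih ⟩
  suc (b + size y) ∎
  where
  open ≡-Reasoning
  ih = size-xPlus1^-⊗ b y nz

size-xPlus1^ : ∀ c → size (xPlus1 ^ₚ c) ≡ suc c
size-xPlus1^ c = begin
  size (xPlus1 ^ₚ c)         ≡⟨ size-cong (⊗-identityʳ (xPlus1 ^ₚ c)) ⟨
  size (xPlus1 ^ₚ c ⊗ oneP)  ≡⟨ size-xPlus1^-⊗ c oneP (s≤s z≤n) ⟩
  c + 1                      ≡⟨ +-comm c 1 ⟩
  suc c                      ∎
  where open ≡-Reasoning

-- Reflection

replicate-∷ʳ : ∀ {A : Set} m (x : A) → replicate m x ++ x ∷ [] ≡ x ∷ replicate m x
replicate-∷ʳ zero    x = refl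
replicate-∷ʳ (suc m) x = cong (x ∷_) (replicate-∷ʳ m x)

reverse-replicate : ∀ {A : Set} m (x : A) → reverse (replicate m x) ≡ replicate m x
reverse-replicate zero    x = refl
reverse-replicate (suc m) x = begin
  reverse (x ∷ replicate m x)       ≡⟨ unfold-reverse x (replicate m x) ⟩
  reverse (replicate m x) ++ x ∷ [] ≡⟨ cong (_++ x ∷ []) (reverse-replicate m x) ⟩
  replicate m x ++ x ∷ []           ≡⟨ replicate-∷ʳ m x ⟩
  x ∷ replicate m x                 ∎
  where open ≡-Reasoning

length-⊕ : ∀ p q → length p ≡ length q → length (p ⊕ q) ≡ length p
length-⊕ []      []      _ = refl
length-⊕ (a ∷ p) (b ∷ q) e = cong suc (length-⊕ p q (suc-injective e))

∷ʳ-⊕ : ∀ p q a b → length p ≡ length q → (p ++ a ∷ []) ⊕ (q ++ b ∷ []) ≡ (p ⊕ q) ++ (a xor b) ∷ []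
∷ʳ-⊕ []      []      a b _ = refl
∷ʳ-⊕ (c ∷ p) (d ∷ q) a b e = cong ((c xor d) ∷_) (∷ʳ-⊕ p q a b (suc-injective e))

reverse-⊕ : ∀ p q → length p ≡ length q → reverse (p ⊕ q) ≡ reverse p ⊕ reverse q
reverse-⊕ []      []      _ = refl
reverse-⊕ (a ∷ p) (b ∷ q) e = begin
  reverse ((a xor b) ∷ p ⊕ q)                     ≡⟨ unfold-reverse (a xor b) (p ⊕ q) ⟩
  reverse (p ⊕ q) ++ (a xor b) ∷ []               ≡⟨ cong (_++ (a xor b) ∷ []) (reverse-⊕ p q e′) ⟩
  (reverse p ⊕ reverse q) ++ (a xor b) ∷ []       ≡⟨ ∷ʳ-⊕ (reverse p) (reverse q) a b lengths ⟨
  (reverse p ++ a ∷ []) ⊕ (reverse q ++ b ∷ [])   ≡⟨ cong₂ _⊕_ (unfold-reverse a p) (unfold-reverse b q) ⟨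
  reverse (a ∷ p) ⊕ reverse (b ∷ q)               ∎
  where
  open ≡-Reasoning
  e′ = suc-injective e
  lengths : length (reverse p) ≡ length (reverse q)
  lengths = trans (length-reverse p) (trans e′ (sym (length-reverse q)))

∷ʳ-false : ∀ p → p ++ false ∷ [] ≈ p
∷ʳ-false []      = false∷-≈[] ≈-refl
∷ʳ-false (a ∷ p) = ∷-cong refl (∷ʳ-false p)

norm-++-zeros : ∀ p → ∃ λ v → p ≡ norm p ++ replicate v false
norm-++-zeros []      = 0 , refl
norm-++-zeros (a ∷ p) with norm-++-zeros p
... | v , eq rewrite norm-∷ a p = extend a (norm p) eq
  where
  extend : ∀ a q → p ≡ q ++ replicate v false → ∃ λ w → a ∷ p ≡ normCons a q ++ replicate w false
  extend true  []      eq = v     , cong (true ∷_) eq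
  extend false []      eq = suc v , cong (false ∷_) eq
  extend a     (_ ∷ _) eq = v     , cong (a ∷_) eq

-- u^(deg R) · R(1/u)
reflect : Poly → Poly
reflect R = reverse (norm R)

reflect-cong : ∀ {R R′} → R ≈ R′ → reflect R ≡ reflect R′
reflect-cong R≈R′ = cong reverse (≈⇒norm≡ R≈R′)

reverse≈monomial⊗reflect : ∀ p → ∃ λ v → reverse p ≈ monomial v ⊗ reflect p
reverse≈monomial⊗reflect p with norm-++-zeros p
... | v , eq = v , (begin
  reverse p                                         ≡⟨ cong reverse eq ⟩
  reverse (norm p ++ replicate v false)             ≡⟨ reverse-++ (norm p) (replicate v false) ⟩
  reverse (replicate v false) ++ reflect p          ≡⟨ cong (_++ reflect p) (reverse-replicate v false) ⟩
  replicate v false ++ reflect p                    ≈⟨ monomial-⊗ v (reflect p) ⟨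
  monomial v ⊗ reflect p                            ∎)
  where open ≈-Reasoning

coeff₀-reflect : ∀ R → 1 ≤ size R → coeff (reflect R) 0 ≡ true
coeff₀-reflect R nz with size R in eq
... | suc k = begin
  coeff (reverse (norm R)) 0    ≡⟨ coeff-reverse (norm R) (subst (0 <_) (sym eq) (s≤s z≤n)) ⟩
  coeff (norm R) (size R ∸ 1)   ≡⟨ cong (λ n → coeff (norm R) (n ∸ 1)) eq ⟩
  coeff (norm R) k              ≡⟨ coeff-≡ (norm≈ R) k ⟩
  coeff R k                     ≡⟨ coeff-top R k eq ⟩
  true                          ∎
  where open ≡-Reasoning

size-reflect : ∀ R → coeff R 0 ≡ true → size (reflect R) ≡ size R
size-reflect R c with size R in eq | coeff≡true⇒<size R c
... | suc k | _ = size-≡ (reflect R) k top above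
  where
  top : coeff (reverse (norm R)) k ≡ true
  top = begin
    coeff (reverse (norm R)) k            ≡⟨ coeff-reverse (norm R) (subst (k <_) (sym eq) ≤-refl) ⟩
    coeff (norm R) (size R ∸ suc k)       ≡⟨ cong (λ n → coeff (norm R) (n ∸ suc k)) eq ⟩
    coeff (norm R) (suc k ∸ suc k)        ≡⟨ cong (coeff (norm R)) (n∸n≡0 k) ⟩
    coeff (norm R) 0                      ≡⟨ coeff-≡ (norm≈ R) 0 ⟩
    coeff R 0                             ≡⟨ c ⟩
    true                                  ∎
    where open ≡-Reasoning
  above : ∀ i → suc k ≤ i → coeff (reverse (norm R)) i ≡ false
  above i le = coeff-≥length (reverse (norm R)) (subst (_≤ i) (sym (trans (length-reverse (norm R)) eq)) le)

-- Through reflect, the Collatz step G ↦ (1 + (1 + u) G) / u^v becomes rstep (reflect-rstep).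
rstep : Poly → Poly
rstep R = xPlus1 ⊗ R ⊕ monomial (size R)

reflect-rstep : ∀ R → ∃ λ v → oneP ⊕ xPlus1 ⊗ reflect R ≈ monomial v ⊗ reflect (rstep R)
reflect-rstep R =
  let open ≈-Reasoning
      v , reverseF≈ = reverse≈monomial⊗reflect F
  in
  v , (begin
    oneP ⊕ xPlus1 ⊗ ř               ≈⟨ reverse-F ⟨
    reverse F                       ≈⟨ reverseF≈ ⟩
    monomial v ⊗ reflect F          ≡⟨ cong (monomial v ⊗_) (reflect-cong F≈rstep) ⟩
    monomial v ⊗ reflect (rstep R)  ∎)
  where
  r = norm R
  m = length r
  ř = reverse r
  F = ((r ++ false ∷ []) ⊕ (false ∷ r)) ⊕ monomial m

  F≈rstep : F ≈ rstep R
  F≈rstep = ⊕-congʳ (begin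
    (r ++ false ∷ []) ⊕ (false ∷ r)  ≈⟨ ⊕-congʳ (∷ʳ-false r) ⟩
    r ⊕ (false ∷ r)                  ≡⟨ ⊕-comm r (false ∷ r) ⟩
    (false ∷ r) ⊕ r                  ≈⟨ xPlus1-⊗ r ⟨
    xPlus1 ⊗ r                       ≈⟨ ⊗-congˡ xPlus1 (norm≈ R) ⟩
    xPlus1 ⊗ R                       ∎)
    where open ≈-Reasoning

  reverse-monomial : reverse (monomial m) ≡ true ∷ replicate m false
  reverse-monomial = trans (reverse-++ (replicate m false) (true ∷ []))
                           (cong (true ∷_) (reverse-replicate m false))

  lengths₁ : length (r ++ false ∷ []) ≡ length (false ∷ r)
  lengths₁ = length-++-comm r (false ∷ [])

  lengths₂ : length ((r ++ false ∷ []) ⊕ (false ∷ r)) ≡ length (monomial m)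
  lengths₂ = begin
    length ((r ++ false ∷ []) ⊕ (false ∷ r)) ≡⟨ length-⊕ (r ++ false ∷ []) (false ∷ r) lengths₁ ⟩
    length (r ++ false ∷ [])                 ≡⟨ length-++-comm r (false ∷ []) ⟩
    suc m                                    ≡⟨ cong suc (length-replicate m) ⟨
    suc (length (replicate m false))         ≡⟨ length-++-comm (replicate m false) (true ∷ []) ⟨
    length (monomial m)                      ∎
    where open ≡-Reasoning

  reverse-F : reverse F ≈ oneP ⊕ xPlus1 ⊗ ř
  reverse-F = begin
    reverse F
      ≡⟨ reverse-⊕ ((r ++ false ∷ []) ⊕ (false ∷ r)) (monomial m) lengths₂ ⟩
    reverse ((r ++ false ∷ []) ⊕ (false ∷ r)) ⊕ reverse (monomial m)
      ≡⟨ cong₂ _⊕_ (reverse-⊕ (r ++ false ∷ []) (false ∷ r) lengths₁) reverse-monomial ⟩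
    (reverse (r ++ false ∷ []) ⊕ reverse (false ∷ r)) ⊕ (true ∷ replicate m false)
      ≡⟨ cong (λ p → (p ⊕ reverse (false ∷ r)) ⊕ (true ∷ replicate m false)) (reverse-++ r (false ∷ [])) ⟩
    ((false ∷ ř) ⊕ reverse (false ∷ r)) ⊕ (true ∷ replicate m false)
      ≡⟨ cong (λ p → ((false ∷ ř) ⊕ p) ⊕ (true ∷ replicate m false)) (unfold-reverse false r) ⟩
    ((false ∷ ř) ⊕ (ř ++ false ∷ [])) ⊕ (true ∷ replicate m false)
      ≈⟨ ⊕-cong (⊕-congˡ (∷ʳ-false ř)) (∷-cong refl (replicate-false≈[] m)) ⟩
    ((false ∷ ř) ⊕ ř) ⊕ oneP
      ≈⟨ ⊕-congʳ (xPlus1-⊗ ř) ⟨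
    xPlus1 ⊗ ř ⊕ oneP
      ≡⟨ ⊕-comm (xPlus1 ⊗ ř) oneP ⟩
    oneP ⊕ xPlus1 ⊗ ř ∎
    where open ≈-Reasoning

-- Removing the factors x and x + 1

coeff₀-xPlus1^-⊗ : ∀ w H → coeff (xPlus1 ^ₚ w ⊗ H) 0 ≡ coeff H 0
coeff₀-xPlus1^-⊗ w H = trans (coeff₀-⊗ (xPlus1 ^ₚ w) H) (cong (_∧ coeff H 0) (coeff₀-xPlus1^ w))
  where
  coeff₀-xPlus1^ : ∀ w → coeff (xPlus1 ^ₚ w) 0 ≡ true
  coeff₀-xPlus1^ zero    = refl
  coeff₀-xPlus1^ (suc w) = trans (coeff₀-⊗ xPlus1 (xPlus1 ^ₚ w)) (coeff₀-xPlus1^ w)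

evalAt1-xPlus1^suc-⊗ : ∀ w H → evalAt1 (xPlus1 ^ₚ suc w ⊗ H) ≡ false
evalAt1-xPlus1^suc-⊗ w H =
  trans (evalAt1-⊗ (xPlus1 ^ₚ suc w) H) (cong (_∧ evalAt1 H) (evalAt1-⊗ xPlus1 (xPlus1 ^ₚ w)))

divXPlus1-∷∷ : ∀ a b p → divXPlus1 (a ∷ b ∷ p) ≡ normCons a (divXPlus1 ((a xor b) ∷ p))
divXPlus1-∷∷ true  true  p with divXPlus1 (false ∷ p)
... | []    = refl
... | _ ∷ _ = refl
divXPlus1-∷∷ true  false p with divXPlus1 (true ∷ p)
... | []    = refl
... | _ ∷ _ = refl
divXPlus1-∷∷ false true  p with divXPlus1 (true ∷ p)
... | []    = refl
... | _ ∷ _ = refl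
divXPlus1-∷∷ false false p with divXPlus1 (false ∷ p)
... | []    = refl
... | _ ∷ _ = refl

xPlus1-⊗-divXPlus1 : ∀ c p → evalAt1 (c ∷ p) ≡ false → xPlus1 ⊗ divXPlus1 (c ∷ p) ≈ c ∷ p
xPlus1-⊗-divXPlus1 c []      e rewrite xor-identityʳ c | e =
  ≈-trans (⊗-zeroʳ xPlus1) (≈-sym (false∷-≈[] ≈-refl))
xPlus1-⊗-divXPlus1 c (b ∷ p) e = begin
  xPlus1 ⊗ divXPlus1 (c ∷ b ∷ p)
    ≡⟨ cong (xPlus1 ⊗_) (divXPlus1-∷∷ c b p) ⟩
  xPlus1 ⊗ normCons c D
    ≈⟨ ⊗-congˡ xPlus1 (normCons≈ c D) ⟩
  xPlus1 ⊗ (c ∷ D)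
    ≈⟨ xPlus1-⊗ (c ∷ D) ⟩
  c ∷ ((c ∷ D) ⊕ D)
    ≡⟨ cong (c ∷_) (split D) ⟩
  c ∷ ((c ∷ []) ⊕ ((false ∷ D) ⊕ D))
    ≈⟨ ∷-cong refl (⊕-congˡ {c ∷ []} (≈-trans (≈-sym (xPlus1-⊗ D)) ih)) ⟩
  c ∷ (c ∷ []) ⊕ ((c xor b) ∷ p)
    ≡⟨ cong (λ a → c ∷ a ∷ p) (trans (sym (xor-assoc c c b)) (cong (_xor b) (xor-same c))) ⟩
  c ∷ b ∷ p ∎
  where
  open ≈-Reasoning
  D = divXPlus1 ((c xor b) ∷ p)
  ih : xPlus1 ⊗ D ≈ (c xor b) ∷ p
  ih = xPlus1-⊗-divXPlus1 (c xor b) p (trans (xor-assoc c b _) e)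
  split : ∀ D → (c ∷ D) ⊕ D ≡ (c ∷ []) ⊕ ((false ∷ D) ⊕ D)
  split []      = cong (_∷ []) (sym (xor-identityʳ c))
  split (_ ∷ _) = refl

stripX1-xPlus1^-⊗ : ∀ w f q H → q ≈ xPlus1 ^ₚ w ⊗ H → coeff H 0 ≡ true → evalAt1 H ≡ true →
                    w < f → stripX1 f q ≈ H
stripX1-xPlus1^-⊗ w (suc f) [] H e c₀ _ _ =
  ⊥-elim (true≢false (trans (sym c₀) (trans (sym (coeff₀-xPlus1^-⊗ w H)) (sym (coeff-≡ e 0)))))
stripX1-xPlus1^-⊗ w (suc f) (a ∷ q) H e c₀ e₁ w<f with evalAt1 (a ∷ q) in ev | w | w<f | e
... | true  | zero  | _         | e = ≈-trans e (⊗-identityˡ H)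
... | true  | suc w | _         | e =
  ⊥-elim (true≢false (trans (sym ev) (trans (evalAt1-cong e) (evalAt1-xPlus1^suc-⊗ w H))))
... | false | zero  | _         | e =
  ⊥-elim (true≢false (trans (sym e₁) (trans (sym (evalAt1-cong (≈-trans e (⊗-identityˡ H)))) ev)))
... | false | suc w | s≤s w<f′ | e = stripX1-xPlus1^-⊗ w f (divXPlus1 (a ∷ q)) H q′≈ c₀ e₁ w<f′
  where
  q′≈ : divXPlus1 (a ∷ q) ≈ xPlus1 ^ₚ w ⊗ H
  q′≈ = xPlus1-⊗-cancel (≈-trans (xPlus1-⊗-divXPlus1 a q ev) (≈-trans e (⊗-assoc xPlus1 (xPlus1 ^ₚ w) H)))

stripX-shift : ∀ a qs → stripX (replicate a false ++ true ∷ qs) ≡ true ∷ qs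
stripX-shift zero    qs = refl
stripX-shift (suc a) qs = stripX-shift a qs

norm-head : ∀ Q → coeff Q 0 ≡ true → ∃ λ qs → norm Q ≡ true ∷ qs
norm-head Q c with norm Q | coeff-≡ (norm≈ Q) 0 | coeff≡true⇒<size Q c
... | b ∷ qs | b≡ | _ = qs , cong (_∷ qs) (trans b≡ c)

core-cong : ∀ {p q} → p ≈ q → core p ≡ core q
core-cong p≈q = cong (λ r → stripX1 (length r) (stripX r)) (≈⇒norm≡ p≈q)

core-monomial⊗xPlus1^⊗ : ∀ a b H → coeff H 0 ≡ true → evalAt1 H ≡ true →
                         core (monomial a ⊗ (xPlus1 ^ₚ b ⊗ H)) ≈ H
core-monomial⊗xPlus1^⊗ a b H c₀ e₁ = let open ≈-Reasoning in begin
  stripX1 (length (norm P)) (stripX (norm P))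
    ≡⟨ cong (λ r → stripX1 (length r) (stripX r)) normP ⟩
  stripX1 (length L) (stripX L)
    ≡⟨ cong (stripX1 (length L)) (stripX-shift a qs) ⟩
  stripX1 (length L) (true ∷ qs)
    ≈⟨ stripX1-xPlus1^-⊗ b (length L) (true ∷ qs) H qs≈ c₀ e₁ fuel ⟩
  H                                            ∎
  where
  Q = xPlus1 ^ₚ b ⊗ H
  P = monomial a ⊗ Q
  head = norm-head Q (trans (coeff₀-xPlus1^-⊗ b H) c₀)
  qs = proj₁ head
  L = replicate a false ++ true ∷ qs
  normQ : norm Q ≡ true ∷ qs
  normQ = proj₂ head
  1≤sizeH : 1 ≤ size H
  1≤sizeH = coeff≡true⇒<size H c₀
  normP : norm P ≡ L
  normP = begin
    norm P
      ≡⟨ ≈⇒norm≡ (monomial-⊗ a Q) ⟩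
    norm (replicate a false ++ Q)
      ≡⟨ norm-shift a Q (coeff≡true⇒<size Q (trans (coeff₀-xPlus1^-⊗ b H) c₀)) ⟩
    replicate a false ++ norm Q
      ≡⟨ cong (replicate a false ++_) normQ ⟩
    L                                 ∎
    where open ≡-Reasoning
  qs≈ : true ∷ qs ≈ Q
  qs≈ = ≈-trans (≈-reflexive (sym normQ)) (norm≈ Q)
  fuel : b < length L
  fuel = begin
    suc b                                       ≡⟨ +-comm 1 b ⟩
    b + 1                                       ≤⟨ +-monoʳ-≤ b 1≤sizeH ⟩
    b + size H                                  ≡⟨ size-xPlus1^-⊗ b H 1≤sizeH ⟨
    size Q                                      ≡⟨ cong length normQ ⟩
    length (true ∷ qs)                          ≤⟨ m≤n+m _ (length (replicate a false)) ⟩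
    length (replicate a false) + length (true ∷ qs) ≡⟨ length-++ (replicate a false) ⟨
    length L                                    ∎
    where open ≤-Reasoning

-- Substituting u = x² + x

x²+x : Poly
x²+x = false ∷ true ∷ true ∷ []

-- embed G = G(x² + x) by Horner's rule; note that oneP ⊕ M reduces to x²+x
embed : Poly → Poly
embed []      = []
embed (a ∷ p) = (a ∷ []) ⊕ x²+x ⊗ embed p

embed-≈[] : ∀ {p} → p ≈ [] → embed p ≈ []
embed-≈[] {[]}    _ = ≈-refl
embed-≈[] {a ∷ p} e rewrite coeff-≡ e zero =
  ≈-trans (⊕-cong (false∷-≈[] ≈-refl) (⊗-congˡ x²+x (embed-≈[] (∷-≈[]⇒≈[] e)))) (⊗-zeroʳ x²+x)

embed-cong : ∀ {p q} → p ≈ q → embed p ≈ embed q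
embed-cong {[]}    e = ≈-sym (embed-≈[] (≈-sym e))
embed-cong {a ∷ p} {[]}    e = embed-≈[] e
embed-cong {a ∷ p} {b ∷ q} e rewrite coeff-≡ e zero =
  ⊕-congˡ {b ∷ []} (⊗-congˡ x²+x (embed-cong (∷-injectiveʳ e)))

embed-⊕ : ∀ p q → embed (p ⊕ q) ≈ embed p ⊕ embed q
embed-⊕ []      q       = ≈-refl
embed-⊕ (a ∷ p) []      = ≈-reflexive (sym (⊕-identityʳ _))
embed-⊕ (a ∷ p) (b ∷ q) = begin
  ((a xor b) ∷ []) ⊕ x²+x ⊗ embed (p ⊕ q)
    ≈⟨ ⊕-congˡ {(a xor b) ∷ []} (⊗-congˡ x²+x (embed-⊕ p q)) ⟩
  ((a xor b) ∷ []) ⊕ x²+x ⊗ (embed p ⊕ embed q)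
    ≈⟨ ⊕-congˡ {(a xor b) ∷ []} (⊗-distribˡ x²+x (embed p) (embed q)) ⟩
  ((a ∷ []) ⊕ (b ∷ [])) ⊕ (x²+x ⊗ embed p ⊕ x²+x ⊗ embed q)
    ≡⟨ ⊕-interchange (a ∷ []) (b ∷ []) (x²+x ⊗ embed p) (x²+x ⊗ embed q) ⟩
  embed (a ∷ p) ⊕ embed (b ∷ q) ∎
  where open ≈-Reasoning

embed-⊗ : ∀ p q → embed (p ⊗ q) ≈ embed p ⊗ embed q
embed-⊗ []      q = ≈-refl
embed-⊗ (a ∷ p) q = begin
  embed (scale a q ⊕ (false ∷ p ⊗ q))
    ≈⟨ embed-⊕ (scale a q) (false ∷ p ⊗ q) ⟩
  embed (scale a q) ⊕ embed (false ∷ p ⊗ q)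
    ≈⟨ ⊕-cong (embed-scale a) (⊕-congʳ (false∷-≈[] ≈-refl)) ⟩
  (a ∷ []) ⊗ embed q ⊕ ([] ⊕ x²+x ⊗ embed (p ⊗ q))
    ≈⟨ ⊕-congˡ {(a ∷ []) ⊗ embed q} (⊗-congˡ x²+x (embed-⊗ p q)) ⟩
  (a ∷ []) ⊗ embed q ⊕ x²+x ⊗ (embed p ⊗ embed q)
    ≈⟨ ⊕-congˡ {(a ∷ []) ⊗ embed q} (⊗-assoc x²+x (embed p) (embed q)) ⟨
  (a ∷ []) ⊗ embed q ⊕ (x²+x ⊗ embed p) ⊗ embed q
    ≈⟨ ⊗-distribʳ (embed q) (a ∷ []) (x²+x ⊗ embed p) ⟨
  embed (a ∷ p) ⊗ embed q ∎
  where
  open ≈-Reasoning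
  embed-scale : ∀ a → embed (scale a q) ≈ (a ∷ []) ⊗ embed q
  embed-scale true  = ≈-sym (⊗-identityˡ (embed q))
  embed-scale false = ≈-sym (false∷-≈[] ≈-refl)

embed-oneP : embed oneP ≈ oneP
embed-oneP = ⊕-congˡ {oneP} (⊗-zeroʳ x²+x)

embed-monomial : ∀ m → embed (monomial m) ≈ x²+x ^ₚ m
embed-monomial zero    = embed-oneP
embed-monomial (suc m) = ≈-trans (⊕-congʳ (false∷-≈[] ≈-refl)) (⊗-congˡ x²+x (embed-monomial m))

embed-xPlus1 : embed xPlus1 ≈ M
embed-xPlus1 = ⊕-congˡ {oneP} (≈-trans (⊗-congˡ x²+x embed-oneP) (⊗-identityʳ x²+x))

coeff₀-embed : ∀ p → coeff (embed p) 0 ≡ coeff p 0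
coeff₀-embed []      = refl
coeff₀-embed (a ∷ p) = begin
  coeff ((a ∷ []) ⊕ x²+x ⊗ embed p) 0      ≡⟨ coeff-⊕ (a ∷ []) (x²+x ⊗ embed p) 0 ⟩
  a xor coeff (x²+x ⊗ embed p) 0           ≡⟨ cong (a xor_) (coeff₀-⊗ x²+x (embed p)) ⟩
  a xor false                              ≡⟨ xor-identityʳ a ⟩
  a                                        ∎
  where open ≡-Reasoning

evalAt1-embed : ∀ p → evalAt1 (embed p) ≡ coeff p 0
evalAt1-embed []      = refl
evalAt1-embed (a ∷ p) = begin
  evalAt1 ((a ∷ []) ⊕ x²+x ⊗ embed p)             ≡⟨ evalAt1-⊕ (a ∷ []) (x²+x ⊗ embed p) ⟩
  (a xor false) xor evalAt1 (x²+x ⊗ embed p)      ≡⟨ cong ((a xor false) xor_) (evalAt1-⊗ x²+x (embed p)) ⟩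
  (a xor false) xor false                         ≡⟨ xor-identityʳ _ ⟩
  a xor false                                     ≡⟨ xor-identityʳ a ⟩
  a                                               ∎
  where open ≡-Reasoning

x²+x-⊗-≈[] : ∀ {y} → x²+x ⊗ y ≈ [] → y ≈ []
x²+x-⊗-≈[] e = xPlus1-⊗-≈[] (∷-≈[]⇒≈[] e)

embed-≈[]⁻¹ : ∀ p → embed p ≈ [] → p ≈ []
embed-≈[]⁻¹ []      _ = ≈-refl
embed-≈[]⁻¹ (a ∷ p) e with trans (sym (coeff₀-embed (a ∷ p))) (coeff-≡ e 0)
... | refl =
  false∷-≈[] (embed-≈[]⁻¹ p (x²+x-⊗-≈[] (≈-trans (≈-sym (⊕-congʳ (false∷-≈[] ≈-refl))) e)))

embed-injective : ∀ {p q} → embed p ≈ embed q → p ≈ q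
embed-injective {p} {q} e = p⊕q≈[]⇒p≈q (embed-≈[]⁻¹ (p ⊕ q) (begin
  embed (p ⊕ q)        ≈⟨ embed-⊕ p q ⟩
  embed p ⊕ embed q    ≈⟨ ⊕-congʳ e ⟩
  embed q ⊕ embed q    ≈⟨ ⊕-self (embed q) ⟩
  []                   ∎))
  where open ≈-Reasoning

x²+x^ : ∀ v → x²+x ^ₚ v ≈ monomial v ⊗ xPlus1 ^ₚ v
x²+x^ v = begin
  x²+x ^ₚ v                           ≈⟨ ^ₚ-congʳ v (∷-cong refl (≈-sym (⊗-identityˡ xPlus1))) ⟩
  (monomial 1 ⊗ xPlus1) ^ₚ v          ≈⟨ ^ₚ-distrib-⊗ (monomial 1) xPlus1 v ⟩
  monomial 1 ^ₚ v ⊗ xPlus1 ^ₚ v       ≈⟨ ⊗-congʳ (xPlus1 ^ₚ v) (monomial1^ v) ⟩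
  monomial v ⊗ xPlus1 ^ₚ v            ∎
  where
  open ≈-Reasoning
  monomial1^ : ∀ v → monomial 1 ^ₚ v ≈ monomial v
  monomial1^ zero    = ≈-refl
  monomial1^ (suc v) = ≈-trans (⊗-congˡ (monomial 1) (monomial1^ v)) (monomial-+ 1 v)

core-x²+x^⊗embed : ∀ v G → coeff G 0 ≡ true → core (x²+x ^ₚ v ⊗ embed G) ≈ embed G
core-x²+x^⊗embed v G c₀ = begin
  core (x²+x ^ₚ v ⊗ embed G)                         ≡⟨ core-cong factorise ⟩
  core (monomial v ⊗ (xPlus1 ^ₚ v ⊗ embed G))        ≈⟨ core-monomial⊗xPlus1^⊗ v v (embed G) c₀′ e₁ ⟩
  embed G                                            ∎
  where
  open ≈-Reasoning
  factorise = ≈-trans (⊗-congʳ (embed G) (x²+x^ v)) (⊗-assoc (monomial v) (xPlus1 ^ₚ v) (embed G))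
  c₀′ = trans (coeff₀-embed G) c₀
  e₁ = trans (evalAt1-embed G) c₀

rstep^ : ℕ → Poly → Poly
rstep^ zero    R = R
rstep^ (suc k) R = rstep (rstep^ k R)

rstep-cong : ∀ {R R′} → R ≈ R′ → rstep R ≈ rstep R′
rstep-cong R≈R′ = ⊕-cong (⊗-congˡ xPlus1 R≈R′) (≈-reflexive (cong monomial (size-cong R≈R′)))

rstep^-cong : ∀ k {R R′} → R ≈ R′ → rstep^ k R ≈ rstep^ k R′
rstep^-cong zero    R≈R′ = R≈R′
rstep^-cong (suc k) R≈R′ = rstep-cong (rstep^-cong k R≈R′)

rstep^-+ : ∀ m k R → rstep^ (m + k) R ≡ rstep^ m (rstep^ k R)
rstep^-+ zero    k R = refl
rstep^-+ (suc m) k R = cong rstep (rstep^-+ m k R)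

rstep-oneP : rstep oneP ≈ oneP
rstep-oneP = ≈-trans (⊕-congʳ {q = monomial 1} (⊗-identityʳ xPlus1)) (∷-cong refl (false∷-≈[] ≈-refl))

rstep^-oneP : ∀ k → rstep^ k oneP ≈ oneP
rstep^-oneP zero    = ≈-refl
rstep^-oneP (suc k) = ≈-trans (rstep-cong (rstep^-oneP k)) rstep-oneP

coeff₀-rstep : ∀ R → coeff R 0 ≡ true → coeff (rstep R) 0 ≡ true
coeff₀-rstep R c₀ with size R in eq | coeff≡true⇒<size R c₀
... | suc m | _ = begin
  coeff (xPlus1 ⊗ R ⊕ monomial (suc m)) 0  ≡⟨ coeff-⊕ (xPlus1 ⊗ R) (monomial (suc m)) 0 ⟩
  coeff (xPlus1 ⊗ R) 0 xor false           ≡⟨ xor-identityʳ _ ⟩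
  coeff (xPlus1 ⊗ R) 0                     ≡⟨ coeff₀-⊗ xPlus1 R ⟩
  coeff R 0                                ≡⟨ c₀ ⟩
  true                                     ∎
  where open ≡-Reasoning

coeff₀-rstep^ : ∀ k R → coeff R 0 ≡ true → coeff (rstep^ k R) 0 ≡ true
coeff₀-rstep^ zero    R c₀ = c₀
coeff₀-rstep^ (suc k) R c₀ = coeff₀-rstep (rstep^ k R) (coeff₀-rstep^ k R c₀)

1≤size-rstep : ∀ R → 1 ≤ size (rstep R)
1≤size-rstep R = evalAt1≡true⇒1≤size (rstep R) (begin
  evalAt1 (xPlus1 ⊗ R ⊕ monomial (size R))
    ≡⟨ evalAt1-⊕ (xPlus1 ⊗ R) (monomial (size R)) ⟩
  evalAt1 (xPlus1 ⊗ R) xor evalAt1 (monomial (size R))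
    ≡⟨ cong₂ _xor_ (evalAt1-⊗ xPlus1 R) (evalAt1-monomial (size R)) ⟩
  true ∎)
  where open ≡-Reasoning

1≤size-rstep^ : ∀ m X → 1 ≤ size X → 1 ≤ size (rstep^ m X)
1≤size-rstep^ zero    X nz = nz
1≤size-rstep^ (suc m) X _  = 1≤size-rstep (rstep^ m X)

size-monomial⊗⊕ : ∀ h X L → size L ≤ h → 1 ≤ size X → size (monomial h ⊗ X ⊕ L) ≡ h + size X
size-monomial⊗⊕ h X L L≤h nz = begin
  size (monomial h ⊗ X ⊕ L)  ≡⟨ size-⊕-dominant (monomial h ⊗ X) L L<hX ⟩
  size (monomial h ⊗ X)      ≡⟨ size-monomial-⊗ h X nz ⟩
  h + size X                 ∎
  where
  open ≡-Reasoning
  L<hX : size L < size (monomial h ⊗ X)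
  L<hX = subst (size L <_) (sym (size-monomial-⊗ h X nz))
               (≤-trans (s≤s L≤h) (subst (_≤ h + size X) (+-comm h 1) (+-monoʳ-≤ h nz)))

rstep-shift : ∀ h X L → size L ≤ h → 1 ≤ size X →
              rstep (monomial h ⊗ X ⊕ L) ≈ monomial h ⊗ rstep X ⊕ xPlus1 ⊗ L
rstep-shift h X L L≤h nz = begin
  xPlus1 ⊗ (u^h ⊗ X ⊕ L) ⊕ monomial (size (u^h ⊗ X ⊕ L))
    ≡⟨ cong (λ n → xPlus1 ⊗ (u^h ⊗ X ⊕ L) ⊕ monomial n) (size-monomial⊗⊕ h X L L≤h nz) ⟩
  xPlus1 ⊗ (u^h ⊗ X ⊕ L) ⊕ monomial (h + size X)
    ≈⟨ ⊕-cong (⊗-distribˡ xPlus1 (u^h ⊗ X) L) (≈-sym (monomial-+ h (size X))) ⟩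
  (xPlus1 ⊗ (u^h ⊗ X) ⊕ xPlus1 ⊗ L) ⊕ u^h ⊗ monomial (size X)
    ≡⟨ ⊕-Properties.xy∙z≈xz∙y (xPlus1 ⊗ (u^h ⊗ X)) (xPlus1 ⊗ L) (u^h ⊗ monomial (size X)) ⟩
  (xPlus1 ⊗ (u^h ⊗ X) ⊕ u^h ⊗ monomial (size X)) ⊕ xPlus1 ⊗ L
    ≈⟨ ⊕-congʳ (⊕-congʳ (⊗-Properties.x∙yz≈y∙xz xPlus1 u^h X)) ⟩
  (u^h ⊗ (xPlus1 ⊗ X) ⊕ u^h ⊗ monomial (size X)) ⊕ xPlus1 ⊗ L
    ≈⟨ ⊕-congʳ (⊗-distribˡ u^h (xPlus1 ⊗ X) (monomial (size X))) ⟨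
  u^h ⊗ rstep X ⊕ xPlus1 ⊗ L ∎
  where
  open ≈-Reasoning
  u^h = monomial h

rstep^-shift : ∀ h X c m → c + m ≤ h → 1 ≤ size X →
               rstep^ m (monomial h ⊗ X ⊕ xPlus1 ^ₚ c) ≈ monomial h ⊗ rstep^ m X ⊕ xPlus1 ^ₚ (c + m)
rstep^-shift h X c zero    _     _  =
  ≈-reflexive (cong (λ n → monomial h ⊗ X ⊕ xPlus1 ^ₚ n) (sym (+-identityʳ c)))
rstep^-shift h X c (suc m) c+m<h nz = begin
  rstep (rstep^ m (u^h ⊗ X ⊕ xPlus1 ^ₚ c))
    ≈⟨ rstep-cong (rstep^-shift h X c m c+m≤h nz) ⟩
  rstep (u^h ⊗ rstep^ m X ⊕ xPlus1 ^ₚ (c + m))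
    ≈⟨ rstep-shift h (rstep^ m X) _ size≤h (1≤size-rstep^ m X nz) ⟩
  u^h ⊗ rstep^ (suc m) X ⊕ xPlus1 ^ₚ suc (c + m)
    ≡⟨ cong (λ n → u^h ⊗ rstep^ (suc m) X ⊕ xPlus1 ^ₚ n) (+-suc c m) ⟨
  u^h ⊗ rstep^ (suc m) X ⊕ xPlus1 ^ₚ (c + suc m) ∎
  where
  open ≈-Reasoning
  u^h = monomial h
  c+m≤h : c + m ≤ h
  c+m≤h = ≤-trans (+-monoʳ-≤ c (n≤1+n m)) c+m<h
  size≤h : size (xPlus1 ^ₚ (c + m)) ≤ h
  size≤h = subst (_≤ h) (trans (+-suc c m) (sym (size-xPlus1^ (c + m)))) c+m<h

2≤size-rstep^-shift : ∀ h X c m → c + m < h → 1 ≤ size X →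
                      2 ≤ size (rstep^ m (monomial h ⊗ X ⊕ xPlus1 ^ₚ c))
2≤size-rstep^-shift h X c m c+m<h nz = begin
  2                                         ≤⟨ +-mono-≤ (≤-trans (s≤s z≤n) c+m<h) (1≤size-rstep^ m X nz) ⟩
  h + size (rstep^ m X)                     ≡⟨ size-monomial⊗⊕ h _ _ size≤h (1≤size-rstep^ m X nz) ⟨
  size (monomial h ⊗ rstep^ m X ⊕ xPlus1 ^ₚ (c + m))  ≡⟨ size-cong (rstep^-shift h X c m (<⇒≤ c+m<h) nz) ⟨
  size (rstep^ m (monomial h ⊗ X ⊕ xPlus1 ^ₚ c))      ∎
  where
  open ≤-Reasoning
  size≤h : size (xPlus1 ^ₚ (c + m)) ≤ h
  size≤h = subst (_≤ h) (sym (size-xPlus1^ (c + m))) c+m<h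

xPlus1^2^ : ∀ s → xPlus1 ^ₚ (2 ^ s) ≈ oneP ⊕ monomial (2 ^ s)
xPlus1^2^ zero    = ⊗-identityʳ xPlus1
xPlus1^2^ (suc s) = begin
  xPlus1 ^ₚ (h + (h + 0))              ≡⟨ cong (λ n → xPlus1 ^ₚ (h + n)) (+-identityʳ h) ⟩
  xPlus1 ^ₚ (h + h)                    ≈⟨ ^ₚ-homo-⊗ xPlus1 h h ⟩
  xPlus1 ^ₚ h ⊗ xPlus1 ^ₚ h            ≈⟨ ⊗-cong (xPlus1^2^ s) (xPlus1^2^ s) ⟩
  (oneP ⊕ u^h) ⊗ (oneP ⊕ u^h)          ≈⟨ oneP⊕-square u^h ⟩
  oneP ⊕ u^h ⊗ u^h                     ≈⟨ ⊕-congˡ {oneP} (monomial-+ h h) ⟩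
  oneP ⊕ monomial (h + h)              ≡⟨ cong (λ n → oneP ⊕ monomial (h + n)) (+-identityʳ h) ⟨
  oneP ⊕ monomial (h + (h + 0))        ∎
  where
  open ≈-Reasoning
  h = 2 ^ s
  u^h = monomial h

headless : ℕ → Poly
headless a = xPlus1 ^ₚ a ⊕ monomial a

1≤size-headless : ∀ b → 1 ≤ b → 1 ≤ size (headless b)
1≤size-headless (suc b) _ = evalAt1≡true⇒1≤size (headless (suc b)) (begin
  evalAt1 (xPlus1 ^ₚ suc b ⊕ monomial (suc b))
    ≡⟨ evalAt1-⊕ (xPlus1 ^ₚ suc b) (monomial (suc b)) ⟩
  evalAt1 (xPlus1 ^ₚ suc b) xor evalAt1 (monomial (suc b))
    ≡⟨ cong₂ _xor_ (evalAt1-⊗ xPlus1 (xPlus1 ^ₚ b)) (evalAt1-monomial b) ⟩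
  true ∎)
  where open ≡-Reasoning

headless-split : ∀ s b → headless (2 ^ s + b) ≈ monomial (2 ^ s) ⊗ headless b ⊕ xPlus1 ^ₚ b
headless-split s b = begin
  xPlus1 ^ₚ (h + b) ⊕ monomial (h + b)
    ≈⟨ ⊕-cong (^ₚ-homo-⊗ xPlus1 h b) (≈-sym (monomial-+ h b)) ⟩
  xPlus1 ^ₚ h ⊗ xPlus1 ^ₚ b ⊕ u^h ⊗ monomial b
    ≈⟨ ⊕-congʳ (⊗-congʳ (xPlus1 ^ₚ b) (xPlus1^2^ s)) ⟩
  (oneP ⊕ u^h) ⊗ xPlus1 ^ₚ b ⊕ u^h ⊗ monomial b
    ≈⟨ ⊕-congʳ (≈-trans (⊗-distribʳ (xPlus1 ^ₚ b) oneP u^h) (⊕-congʳ (⊗-identityˡ (xPlus1 ^ₚ b)))) ⟩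
  (xPlus1 ^ₚ b ⊕ u^h ⊗ xPlus1 ^ₚ b) ⊕ u^h ⊗ monomial b
    ≡⟨ ⊕-Properties.xy∙z≈yz∙x (xPlus1 ^ₚ b) (u^h ⊗ xPlus1 ^ₚ b) (u^h ⊗ monomial b) ⟩
  (u^h ⊗ xPlus1 ^ₚ b ⊕ u^h ⊗ monomial b) ⊕ xPlus1 ^ₚ b
    ≈⟨ ⊕-congʳ (⊗-distribˡ u^h (xPlus1 ^ₚ b) (monomial b)) ⟨
  u^h ⊗ headless b ⊕ xPlus1 ^ₚ b ∎
  where
  open ≈-Reasoning
  h = 2 ^ s
  u^h = monomial h

rstep^-headless-+2^ : ∀ s b k → 1 ≤ b → b + k ≡ 2 ^ s → rstep^ k (headless b) ≈ oneP →
                      rstep^ k (headless (2 ^ s + b)) ≈ oneP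
rstep^-headless-+2^ s b k 1≤b b+k≡h ih = begin
  rstep^ k (headless (h + b))
    ≈⟨ rstep^-cong k (headless-split s b) ⟩
  rstep^ k (u^h ⊗ headless b ⊕ xPlus1 ^ₚ b)
    ≈⟨ rstep^-shift h (headless b) b k (≤-reflexive b+k≡h) (1≤size-headless b 1≤b) ⟩
  u^h ⊗ rstep^ k (headless b) ⊕ xPlus1 ^ₚ (b + k)
    ≈⟨ ⊕-cong (⊗-congˡ u^h ih) (≈-reflexive (cong (xPlus1 ^ₚ_) b+k≡h)) ⟩
  u^h ⊗ oneP ⊕ xPlus1 ^ₚ h
    ≈⟨ ⊕-cong (⊗-identityʳ u^h) (xPlus1^2^ s) ⟩
  u^h ⊕ (oneP ⊕ u^h)
    ≡⟨ ⊕-Properties.x∙yz≈y∙xz u^h oneP u^h ⟩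
  oneP ⊕ (u^h ⊕ u^h)
    ≈⟨ ⊕-congˡ {oneP} (⊕-self u^h) ⟩
  oneP ∎
  where
  open ≈-Reasoning
  h = 2 ^ s
  u^h = monomial h

rstep^-headless : ∀ s a k → 1 ≤ a → a + k ≡ 2 ^ s → rstep^ k (headless a) ≈ oneP
rstep^-headless zero    (suc zero) zero _   _ = rstep-oneP
rstep^-headless (suc s) a          k 1≤a a+k≡2h with a ≤? 2 ^ s
... | yes a≤h with m≤n⇒∃[o]m+o≡n a≤h
...   | k′ , a+k′≡h = subst (λ k → rstep^ k (headless a) ≈ oneP) (sym k≡h+k′) (begin
  rstep^ (h + k′) (headless a)     ≡⟨ rstep^-+ h k′ (headless a) ⟩
  rstep^ h (rstep^ k′ (headless a)) ≈⟨ rstep^-cong h (rstep^-headless s a k′ 1≤a a+k′≡h) ⟩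
  rstep^ h oneP                    ≈⟨ rstep^-oneP h ⟩
  oneP                             ∎)
  where
  open ≈-Reasoning
  h = 2 ^ s
  k≡h+k′ : k ≡ h + k′
  k≡h+k′ = +-cancelˡ-≡ a k (h + k′)
    (trans a+k≡2h (subst (λ h → h + (h + 0) ≡ a + (h + k′)) a+k′≡h (arith a k′)))
    where
    arith : ∀ a k′ → (a + k′) + ((a + k′) + 0) ≡ a + ((a + k′) + k′)
    arith = solve-∀
rstep^-headless (suc s) a k 1≤a a+k≡2h | no a≰h with m≤n⇒∃[o]m+o≡n (<⇒≤ (≰⇒> a≰h))
...   | b , h+b≡a = subst (λ a → rstep^ k (headless a) ≈ oneP) h+b≡a
                          (rstep^-headless-+2^ s b k 1≤b b+k≡h (rstep^-headless s b k 1≤b b+k≡h))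
  where
  h = 2 ^ s
  1≤b : 1 ≤ b
  1≤b = +-cancelˡ-< h 0 b (subst₂ _<_ (sym (+-identityʳ h)) (sym h+b≡a) (≰⇒> a≰h))
  b+k≡h : b + k ≡ h
  b+k≡h = +-cancelˡ-≡ h (b + k) h (begin
    h + (b + k)   ≡⟨ +-assoc h b k ⟨
    (h + b) + k   ≡⟨ cong (_+ k) h+b≡a ⟩
    a + k         ≡⟨ a+k≡2h ⟩
    h + (h + 0)   ≡⟨ cong (h +_) (+-identityʳ h) ⟩
    h + h         ∎)
    where open ≡-Reasoning

oneP⊕M⊗embed : ∀ G → oneP ⊕ M ⊗ embed G ≈ embed (oneP ⊕ xPlus1 ⊗ G)
oneP⊕M⊗embed G = begin
  oneP ⊕ M ⊗ embed G
    ≈⟨ ⊕-cong (≈-sym embed-oneP) (⊗-congʳ (embed G) (≈-sym embed-xPlus1)) ⟩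
  embed oneP ⊕ embed xPlus1 ⊗ embed G
    ≈⟨ ⊕-congˡ {embed oneP} (embed-⊗ xPlus1 G) ⟨
  embed oneP ⊕ embed (xPlus1 ⊗ G)
    ≈⟨ embed-⊕ oneP (xPlus1 ⊗ G) ⟨
  embed (oneP ⊕ xPlus1 ⊗ G) ∎
  where open ≈-Reasoning

collatzOdd≈embed-reflect : ∀ {A R₀} → coeff R₀ 0 ≡ true → A ≈ embed (reflect R₀) →
                           ∀ k → collatzOdd A k ≈ embed (reflect (rstep^ k R₀))
collatzOdd≈embed-reflect {A} {R₀} c₀ A≈ zero = begin
  core A
    ≡⟨ core-cong (≈-trans A≈ (≈-sym (⊗-identityˡ _))) ⟩
  core (x²+x ^ₚ 0 ⊗ embed (reflect R₀))
    ≈⟨ core-x²+x^⊗embed 0 (reflect R₀) (coeff₀-reflect R₀ (coeff≡true⇒<size R₀ c₀)) ⟩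
  embed (reflect R₀) ∎
  where open ≈-Reasoning
collatzOdd≈embed-reflect {A} {R₀} c₀ A≈ (suc k) =
  let open ≈-Reasoning
      v , reflect-step = reflect-rstep Rₖ
  in begin
  core (oneP ⊕ M ⊗ collatzOdd A k)
    ≡⟨ core-cong (begin
      oneP ⊕ M ⊗ collatzOdd A k
        ≈⟨ ⊕-congˡ {oneP} (⊗-congˡ M (collatzOdd≈embed-reflect c₀ A≈ k)) ⟩
      oneP ⊕ M ⊗ embed (reflect Rₖ)
        ≈⟨ oneP⊕M⊗embed (reflect Rₖ) ⟩
      embed (oneP ⊕ xPlus1 ⊗ reflect Rₖ)
        ≈⟨ embed-cong reflect-step ⟩
      embed (monomial v ⊗ reflect (rstep Rₖ))
        ≈⟨ embed-⊗ (monomial v) (reflect (rstep Rₖ)) ⟩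
      embed (monomial v) ⊗ embed (reflect (rstep Rₖ)) ≈⟨ ⊗-congʳ _ (embed-monomial v) ⟩
      x²+x ^ₚ v ⊗ embed (reflect (rstep Rₖ))          ∎) ⟩
  core (x²+x ^ₚ v ⊗ embed (reflect (rstep Rₖ)))
    ≈⟨ core-x²+x^⊗embed v (reflect (rstep Rₖ)) (coeff₀-reflect (rstep Rₖ) (1≤size-rstep Rₖ)) ⟩
  embed (reflect (rstep Rₖ)) ∎
  where
  Rₖ = rstep^ k R₀

collatzLength-reflect : ∀ {A R₀} N → coeff R₀ 0 ≡ true → A ≈ embed (reflect R₀) →
                        rstep^ N R₀ ≈ oneP →
                        (∀ k → k < N → 2 ≤ size (rstep^ k R₀)) → CollatzLength A (suc N)
collatzLength-reflect {A} {R₀} N c₀ A≈ hits-one 2≤size = N , refl , isOne , notOne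
  where
  orbit = collatzOdd≈embed-reflect c₀ A≈

  isOne : IsOne (collatzOdd A N)
  isOne = begin
    norm (collatzOdd A N)                 ≡⟨ ≈⇒norm≡ (orbit N) ⟩
    norm (embed (reflect (rstep^ N R₀)))  ≡⟨ cong (λ G → norm (embed G)) (reflect-cong hits-one) ⟩
    norm (embed oneP)                     ≡⟨ ≈⇒norm≡ embed-oneP ⟩
    oneP                                  ∎
    where open ≡-Reasoning

  notOne : ∀ k → k < N → ¬ IsOne (collatzOdd A k)
  notOne k k<N one = <-irrefl refl (subst (2 ≤_) size≡1 (2≤size k k<N))
    where
    reflect≈oneP : reflect (rstep^ k R₀) ≈ oneP
    reflect≈oneP = embed-injective (begin
      embed (reflect (rstep^ k R₀))   ≈⟨ orbit k ⟨
      collatzOdd A k                  ≈⟨ norm≈ (collatzOdd A k) ⟨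
      norm (collatzOdd A k)           ≡⟨ one ⟩
      oneP                            ≈⟨ embed-oneP ⟨
      embed oneP                      ∎)
      where open ≈-Reasoning
    size≡1 : size (rstep^ k R₀) ≡ 1
    size≡1 = trans (sym (size-reflect (rstep^ k R₀) (coeff₀-rstep^ k R₀ c₀))) (size-cong reflect≈oneP)

-- The trajectory of u^n + 1

reflect-monomial⊕oneP : ∀ n → 1 ≤ n → reflect (monomial n ⊕ oneP) ≡ monomial n ⊕ oneP
reflect-monomial⊕oneP (suc m) _ = begin
  reverse (norm (true ∷ monomial m ⊕ []))
    ≡⟨ cong (λ p → reverse (norm (true ∷ p))) (⊕-identityʳ (monomial m)) ⟩
  reverse (norm (true ∷ monomial m))
    ≡⟨ cong reverse normal ⟩
  reverse (true ∷ monomial m)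
    ≡⟨ unfold-reverse true (monomial m) ⟩
  reverse (monomial m) ++ true ∷ []
    ≡⟨ cong (_++ true ∷ []) (reverse-++ (replicate m false) (true ∷ [])) ⟩
  true ∷ reverse (replicate m false) ++ true ∷ []
    ≡⟨ cong (λ p → true ∷ p ++ true ∷ []) (reverse-replicate m false) ⟩
  true ∷ monomial m
    ≡⟨ cong (true ∷_) (⊕-identityʳ (monomial m)) ⟨
  true ∷ monomial m ⊕ [] ∎
  where
  open ≡-Reasoning
  normal : norm (true ∷ monomial m) ≡ true ∷ monomial m
  normal = begin
    norm (true ∷ monomial m)                ≡⟨ norm-∷ true (monomial m) ⟩
    normCons true (norm (monomial m))       ≡⟨ cong (normCons true) (norm-shift m oneP (s≤s z≤n)) ⟩
    normCons true (monomial m)              ≡⟨ normCons-nonempty true (monomial m) nonempty ⟩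
    true ∷ monomial m                       ∎
    where
    nonempty : 1 ≤ length (monomial m)
    nonempty = subst (1 ≤_) (sym (length-++ (replicate m false))) (m≤n+m 1 _)

collatzLength-x²+x^⊕oneP : ∀ s n → 2 ^ s < n → n ≤ 2 ^ suc s →
                           CollatzLength (x²+x ^ₚ n ⊕ oneP) (suc (2 ^ suc s))
collatzLength-x²+x^⊕oneP s n h<n n≤2h
  with m≤n⇒∃[o]m+o≡n (<⇒≤ h<n) | m≤n⇒∃[o]m+o≡n n≤2h
... | b , refl | j , n+j≡2h =
  subst (λ N → CollatzLength (x²+x ^ₚ n ⊕ oneP) (suc N)) (trans (+-comm j n) n+j≡2h)
    (collatzLength-reflect (j + n) c₀ A≈ hits-one 2≤size)
  where
  h = 2 ^ s
  R₀ = monomial n ⊕ oneP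

  1≤b : 1 ≤ b
  1≤b = +-cancelˡ-< h 0 b (subst (_< h + b) (sym (+-identityʳ h)) h<n)
  1≤n : 1 ≤ n
  1≤n = ≤-trans 1≤b (m≤n+m b h)
  b+j≡h : b + j ≡ h
  b+j≡h = +-cancelˡ-≡ h (b + j) h (trans (sym (+-assoc h b j)) (trans n+j≡2h (cong (h +_) (+-identityʳ h))))

  c₀ : coeff R₀ 0 ≡ true
  c₀ = coeff₀ n 1≤n
    where
    coeff₀ : ∀ n → 1 ≤ n → coeff (monomial n ⊕ oneP) 0 ≡ true
    coeff₀ (suc _) _ = refl

  A≈ : x²+x ^ₚ n ⊕ oneP ≈ embed (reflect R₀)
  A≈ = begin
    x²+x ^ₚ n ⊕ oneP               ≈⟨ ⊕-cong (embed-monomial n) embed-oneP ⟨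
    embed (monomial n) ⊕ embed oneP ≈⟨ embed-⊕ (monomial n) oneP ⟨
    embed R₀                        ≡⟨ cong embed (reflect-monomial⊕oneP n 1≤n) ⟨
    embed (reflect R₀)              ∎
    where open ≈-Reasoning

  R₀≈ : R₀ ≈ monomial n ⊗ oneP ⊕ xPlus1 ^ₚ 0
  R₀≈ = ⊕-congʳ (≈-sym (⊗-identityʳ (monomial n)))

  rstep^n-R₀ : rstep^ n R₀ ≈ headless n
  rstep^n-R₀ = begin
    rstep^ n R₀
      ≈⟨ rstep^-cong n R₀≈ ⟩
    rstep^ n (monomial n ⊗ oneP ⊕ xPlus1 ^ₚ 0)
      ≈⟨ rstep^-shift n oneP 0 n ≤-refl (s≤s z≤n) ⟩
    monomial n ⊗ rstep^ n oneP ⊕ xPlus1 ^ₚ n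
      ≈⟨ ⊕-congʳ (≈-trans (⊗-congˡ (monomial n) (rstep^-oneP n)) (⊗-identityʳ _)) ⟩
    monomial n ⊕ xPlus1 ^ₚ n
      ≡⟨ ⊕-comm (monomial n) (xPlus1 ^ₚ n) ⟩
    headless n ∎
    where open ≈-Reasoning

  hits-one : rstep^ (j + n) R₀ ≈ oneP
  hits-one = begin
    rstep^ (j + n) R₀        ≡⟨ rstep^-+ j n R₀ ⟩
    rstep^ j (rstep^ n R₀)   ≈⟨ rstep^-cong j rstep^n-R₀ ⟩
    rstep^ j (headless n)    ≈⟨ rstep^-headless (suc s) n j 1≤n n+j≡2h ⟩
    oneP                     ∎
    where open ≈-Reasoning

  2≤size : ∀ k → k < j + n → 2 ≤ size (rstep^ k R₀)
  2≤size k k<N with k <? n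
  ... | yes k<n = subst (2 ≤_) (sym (size-cong (rstep^-cong k R₀≈)))
                        (2≤size-rstep^-shift n oneP 0 k k<n (s≤s z≤n))
  ... | no  k≮n with m≤n⇒∃[o]m+o≡n (≮⇒≥ k≮n)
  ...   | i , refl = subst (2 ≤_) (size-cong late)
                         (2≤size-rstep^-shift h (headless b) b i b+i<h (1≤size-headless b 1≤b))
    where
    b+i<h : b + i < h
    b+i<h = subst (b + i <_) b+j≡h (+-monoʳ-< b (+-cancelˡ-< n i j (subst (n + i <_) (+-comm j n) k<N)))
    late : rstep^ i (monomial h ⊗ headless b ⊕ xPlus1 ^ₚ b) ≈ rstep^ (n + i) R₀
    late = begin
      rstep^ i (monomial h ⊗ headless b ⊕ xPlus1 ^ₚ b)  ≈⟨ rstep^-cong i (headless-split s b) ⟨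
      rstep^ i (headless n)                              ≈⟨ rstep^-cong i rstep^n-R₀ ⟨
      rstep^ i (rstep^ n R₀)                             ≡⟨ rstep^-+ i n R₀ ⟨
      rstep^ (i + n) R₀                                  ≡⟨ cong (λ k → rstep^ k R₀) (+-comm i n) ⟩
      rstep^ (n + i) R₀                                  ∎
      where open ≈-Reasoning

proposition3p9 : (r j : ℕ) → 2 ≤ r → 1 ≤ j → j ≤ 2 ^ (r ∸ 1) ∸ 1 →
    CollatzLength (((oneP ⊕ M) ^ₚ (2 ^ r ∸ j)) ⊕ oneP) (2 ^ r + 1)
proposition3p9 (suc s) j _ _ j≤h∸1 =
  subst (CollatzLength (x²+x ^ₚ (2 ^ suc s ∸ j) ⊕ oneP)) (+-comm 1 (2 ^ suc s))
    (collatzLength-x²+x^⊕oneP s (2 ^ suc s ∸ j) h<n (m∸n≤m (2 ^ suc s) j))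
  where
  h = 2 ^ s
  j<h : j < h
  j<h = ≤-<-trans j≤h∸1 (∸-monoʳ-< (s≤s z≤n) (m^n>0 2 s))
  h<n : h < 2 ^ suc s ∸ j
  h<n = subst (h <_) (sym (+-∸-assoc h (<⇒≤ j<h′))) (m<m+n h (m<n⇒0<n∸m j<h′))
    where
    j<h′ : j < h + 0
    j<h′ = subst (j <_) (sym (+-identityʳ h)) j<h
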